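{- Let $m\ge 2$ be an integer, and let $x_1,\dotsc,x_{m-1}$ be odd positive integers such that for all positive integers $i,k$ with $i<k\le m-1$, \[ x_k>\frac{(x_i-2)x_{i}\cdots x_{k-1}}{2\sigma_{k-i-1}(x_i,\dotsc, x_{k-1})-x_i^2\sigma_{k-i-2}(x_{i+1},\dotsc, x_{k-1})}. \] Let $b$ be the smallest odd positive integer greater than \[ \max_{i\in\{1,\dots,m-1\}}\biggl\{\frac{(x_i-2)x_{i}\cdots x_{m-1}}{2\sigma_{m-i-1}(x_i,\dotsc, x_{m-1})-x_i^2\sigma_{m-i-2}(x_{i+1},\dotsc, x_{m-1})}\biggr\}. \] Then the rational numbers whose odd greedy expansion has length $m$ and begins with denominators $x_1,\dotsc,x_{m-1}$ (in this order) are exactly those of the form \[ \frac{\sigma_{m-1}(x_1,\dotsc ,x_{m-1},b)+2\sigma_{m-2}(x_1,\dotsc ,x_{m-1})t}{x_1\cdots x_{m-1}b+2x_1\cdots x_{m-1}t}, \] where $t$ is any nonnegative integer.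
   Context: For variables $y_1,\dots,y_r$ ($r\ge 0$) and an integer $k$, $\sigma_k(y_1,\dots,y_r)=\sum_{I\subseteq\{1,\dots,r\},|I|=k}\prod_{i\in I}y_i$ is the elementary symmetric polynomial; $\sigma_0=1$ (also for an empty list of variables), $\sigma_k=0$ for $k<0$ and for $k>r$. Odd greedy expansion: given a positive rational $q$, define $x_1,x_2,\dots$ recursively: writing $R_i=q-\sum_{j=1}^{i-1}1/x_j$, if $R_i\ge1$ let $x_i=1$, and if $0<R_i<1$ let $x_i$ be the unique odd positive integer with $\frac1{x_i}\le R_i<\frac1{x_i-2}$; stop when the remainder is $0$. The $x_i$ are the denominators, and the number of terms is the length. -}

module Defs where

open import Data.Nat as ℕ using (ℕ; zero; suc; _∸_)
open import Data.Integer as ℤ using (ℤ; +_; -[1+_])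
open import Data.Rational as ℚ using (ℚ)
open import Data.List using (List; []; _∷_; map; foldr; upTo)
open import Data.Product using (Σ; _×_)
open import Data.Sum using (_⊎_)
open import Relation.Binary.PropositionalEquality using (_≡_)

-- odd natural number (automatically positive)
Odd : ℕ → Set
Odd n = Σ ℕ λ k → n ≡ suc (2 ℕ.* k)

-- elementary symmetric polynomial σ_k(y_1,…,y_r), index k ∈ ℤ;
-- σ_0 = 1 (also for the empty list), σ_k = 0 for k < 0 and for k > r.
σₙ : ℕ → List ℤ → ℤ
σₙ zero    ys       = + 1
σₙ (suc k) []       = + 0
σₙ (suc k) (y ∷ ys) = y ℤ.* σₙ k ys ℤ.+ σₙ (suc k) ys

σ : ℤ → List ℤ → ℤ
σ (+ k)    ys = σₙ k ys
σ -[1+ k ] ys = + 0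

seg : (ℕ → ℕ) → ℕ → ℕ → List ℤ
seg x a n = map (λ j → + x (a ℕ.+ j)) (upTo n)

-- rational a/d; only ever used with d > 0 (the d = 0 clause is never reached)
_//_ : ℤ → ℕ → ℚ
a // zero    = ℚ.0ℚ
a // suc d   = a ℚ./ suc d

recip : ℕ → ℚ
recip x = (+ 1) // x

-- One step of the odd greedy algorithm: x is the denominator chosen for
-- the remainder R (assumed 0 < R):
--   R ≥ 1  ⇒ x = 1;   0 < R < 1 ⇒ x odd with 1/x ≤ R < 1/(x-2).
GreedyStep : ℚ → ℕ → Set
GreedyStep R x =
  (ℚ.1ℚ ℚ.≤ R × x ≡ 1)
  ⊎ (R ℚ.< ℚ.1ℚ × Odd x × recip x ℚ.≤ R × R ℚ.< recip (x ∸ 2))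

-- OddGreedy q xs : the odd greedy expansion of q terminates and its list
-- of denominators is exactly xs (so its length is the length of xs).
data OddGreedy : ℚ → List ℕ → Set where
  stop : ∀ {R} → R ≡ ℚ.0ℚ → OddGreedy R []
  step : ∀ {R x xs} → ℚ.0ℚ ℚ.< R → GreedyStep R x →
         OddGreedy (R ℚ.- recip x) xs → OddGreedy R (x ∷ xs)

prodℤ : List ℤ → ℤ
prodℤ = foldr ℤ._*_ (+ 1)

Num : (ℕ → ℕ) → ℕ → ℕ → ℤ
Num x i k = (+ x i ℤ.- + 2) ℤ.* prodℤ (seg x i (k ∸ i))

Den : (ℕ → ℕ) → ℕ → ℕ → ℤ
Den x i k = + 2 ℤ.* σ (+ k ℤ.- + i ℤ.- + 1) (seg x i (k ∸ i))
            ℤ.- (+ x i ℤ.* + x i) ℤ.* σ (+ k ℤ.- + i ℤ.- + 2) (seg x (suc i) (k ∸ i ∸ 1))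

-- The odd greedy expansion of q has denominators x₁, …, x_{m−1}, y exactly when
-- q = 1/x₁ + ⋯ + 1/x_{m−1} + 1/y and every step is greedy.  With odd denominators the
-- only greedy inequality that is not automatic is Rᵢ < 1/(xᵢ − 2) (when xᵢ > 1) for the
-- remainder Rᵢ = 1/xᵢ + ⋯ + 1/x_{m−1} + 1/y.  Writing Rᵢ as a fraction whose numerator
-- and denominator are σ_{n−1} and σₙ of xᵢ, …, x_{m−1}, y, this inequality
-- cross-multiplies to the i-th bound of the theorem.  Since Rᵢ decreases as y grows,
-- the odd y meeting all bounds are b, b + 2, b + 4, …, and substituting y = b + 2t into
-- the sum gives the fraction.

{-# OPTIONS --safe #-}
module Submission where

open import Defs
open import Data.Nat as ℕ using (ℕ; suc; _∸_; _≤_; _<_)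
open import Data.Integer as ℤ using (ℤ; +_)
open import Data.Rational as ℚ using (ℚ)
open import Data.List using (List; []; _∷_; map; foldr; upTo; _++_)
open import Data.Product using (Σ)
open import Function.Bundles using (_⇔_)
open import Relation.Binary.PropositionalEquality using (_≡_)

open import Data.Nat using (zero; z≤n; s≤s; NonZero)
import Data.Nat.Properties as ℕP
import Data.Nat.Tactic.RingSolver as ℕ-Solver
open import Data.Nat.ListAction using (product)
open import Data.Nat.ListAction.Properties using (product≢0)
import Data.Integer.Properties as ℤP
open import Data.Integer.Tactic.RingSolver using (solve-∀)
import Data.Rational.Properties as ℚP
open import Data.Rational.Unnormalised as ℚᵘ using (mkℚᵘ)
import Data.Rational.Unnormalised.Properties as ℚᵘP
open import Data.List using (length; applyUpTo)
open import Data.List.Properties using (map-applyUpTo; map-id)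
open import Data.List.Relation.Unary.All as All using (All; []; _∷_)
open import Data.Product using (_×_; _,_; proj₂)
open import Data.Product.Function.NonDependent.Propositional using (_×-⇔_)
open import Data.Sum using (_⊎_; inj₁; inj₂; map₂)
open import Function.Base using (_∘_; id)
open import Function.Bundles using (mk⇔; Equivalence)
open import Function.Construct.Composition using (_⇔-∘_)
open import Function.Construct.Identity using (⇔-id)
open import Relation.Binary.PropositionalEquality hiding (_≡_)
open import Relation.Nullary using (contradiction)
import Algebra.Properties.AbelianGroup ℚP.+-0-abelianGroup as ℚ+
import Algebra.Properties.AbelianGroup ℤP.+-0-abelianGroup as ℤ+

open Equivalence using (to; from)

odd⇒nonZero : ∀ {z} → Odd z → NonZero z
odd⇒nonZero (_ , refl) = _

odd⇒1⊎3≤ : ∀ {z} → Odd z → z ≡ 1 ⊎ 3 ≤ z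
odd⇒1⊎3≤ (zero  , refl) = inj₁ refl
odd⇒1⊎3≤ (suc k , refl) = inj₂ (s≤s (s≤s (ℕP.≤-trans (s≤s z≤n) (ℕP.m≤n+m _ k))))

odd-+-even : ∀ {b} t → Odd b → Odd (b ℕ.+ 2 ℕ.* t)
odd-+-even t (k , refl) = k ℕ.+ t , cong suc (sym (ℕP.*-distribˡ-+ 2 k t))

odd-≤⇒≡+2* : ∀ {b y} → Odd b → Odd y → b ≤ y → Σ ℕ λ t → y ≡ b ℕ.+ 2 ℕ.* t
odd-≤⇒≡+2* (k , refl) (k′ , refl) (s≤s 2k≤2k′) = k′ ∸ k , cong suc (begin
  2 ℕ.* k′               ≡⟨ cong (2 ℕ.*_) (ℕP.m+[n∸m]≡n {k} {k′} (ℕP.*-cancelˡ-≤ 2 2k≤2k′)) ⟨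
  2 ℕ.* (k ℕ.+ (k′ ∸ k)) ≡⟨ ℕP.*-distribˡ-+ 2 k (k′ ∸ k) ⟩
  2 ℕ.* k ℕ.+ 2 ℕ.* (k′ ∸ k) ∎)
  where open ≡-Reasoning

pos-*+ : ∀ a b c → + (a ℕ.* b ℕ.+ c) ≡ + a ℤ.* + b ℤ.+ + c
pos-*+ a b c = trans (ℤP.pos-+ (a ℕ.* b) c) (cong (ℤ._+ + c) (ℤP.pos-* a b))

m+1+n≡1+o⇒m≤o : ∀ {m n o} → m ℕ.+ suc n ≡ suc o → m ≤ o
m+1+n≡1+o⇒m≤o {m} e = ℕP.≤-pred (subst (m <_) e (ℕP.m<m+n m (s≤s z≤n)))

//-≃ : ∀ a d → ℚ.toℚᵘ (a // suc d) ℚᵘ.≃ mkℚᵘ a d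
//-≃ a d = ℚP.toℚᵘ-fromℚᵘ (mkℚᵘ a d)

//-≤⇔ : ∀ a b d e .{{_ : NonZero d}} .{{_ : NonZero e}} →
       a // d ℚ.≤ b // e ⇔ a ℤ.* + e ℤ.≤ b ℤ.* + d
//-≤⇔ a b (suc d) (suc e) = mk⇔
  (λ p≤q → ℚᵘP.drop-*≤* (ℚᵘP.≤-respʳ-≃ (//-≃ b e) (ℚᵘP.≤-respˡ-≃ (//-≃ a d) (ℚP.toℚᵘ-mono-≤ p≤q))))
  (λ ≤ → ℚP.toℚᵘ-cancel-≤
           (ℚᵘP.≤-respʳ-≃ (ℚᵘP.≃-sym (//-≃ b e)) (ℚᵘP.≤-respˡ-≃ (ℚᵘP.≃-sym (//-≃ a d)) (ℚᵘ.*≤* ≤))))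

//-<⇔ : ∀ a b d e .{{_ : NonZero d}} .{{_ : NonZero e}} →
       a // d ℚ.< b // e ⇔ a ℤ.* + e ℤ.< b ℤ.* + d
//-<⇔ a b (suc d) (suc e) = mk⇔
  (λ p<q → ℚᵘP.drop-*<* (ℚᵘP.<-respʳ-≃ (//-≃ b e) (ℚᵘP.<-respˡ-≃ (//-≃ a d) (ℚP.toℚᵘ-mono-< p<q))))
  (λ < → ℚP.toℚᵘ-cancel-<
           (ℚᵘP.<-respʳ-≃ (ℚᵘP.≃-sym (//-≃ b e)) (ℚᵘP.<-respˡ-≃ (ℚᵘP.≃-sym (//-≃ a d)) (ℚᵘ.*<* <))))

//-+ : ∀ a b d e .{{_ : NonZero d}} .{{_ : NonZero e}} →
       a // d ℚ.+ b // e ≡ (a ℤ.* + e ℤ.+ b ℤ.* + d) // (d ℕ.* e)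
//-+ a b (suc d) (suc e) = ℚP.toℚᵘ-injective (ℚᵘP.≃-trans (ℚP.toℚᵘ-homo-+ (a // suc d) (b // suc e))
  (ℚᵘP.≃-trans (ℚᵘP.+-cong (//-≃ a d) (//-≃ b e)) (ℚᵘP.≃-sym (//-≃ _ _))))

recip-nonneg : ∀ x → ℚ.0ℚ ℚ.≤ recip x
recip-nonneg zero    = ℚP.≤-refl
recip-nonneg (suc x) = from (//-≤⇔ (+ 0) (+ 1) 1 (suc x)) (ℤ.+≤+ z≤n)

recip-pos : ∀ x .{{_ : NonZero x}} → ℚ.0ℚ ℚ.< recip x
recip-pos x = from (//-<⇔ (+ 0) (+ 1) 1 x) (ℤ.+<+ (s≤s z≤n))

recip-antitone : ∀ {y y′} .{{_ : NonZero y}} → y ≤ y′ → recip y′ ℚ.≤ recip y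
recip-antitone {y} {y′} y≤y′ =
  from (//-≤⇔ (+ 1) (+ 1) y′ y {{ℕ.>-nonZero (ℕP.<-≤-trans (ℕ.>-nonZero⁻¹ y) y≤y′)}})
    (subst₂ ℤ._≤_ (sym (ℤP.*-identityˡ (+ y))) (sym (ℤP.*-identityˡ (+ y′))) (ℤ.+≤+ y≤y′))

sumRecip : List ℕ → ℚ
sumRecip = foldr (λ x r → recip x ℚ.+ r) ℚ.0ℚ

sumRecip-nonneg : ∀ s → ℚ.0ℚ ℚ.≤ sumRecip s
sumRecip-nonneg []      = ℚP.≤-refl
sumRecip-nonneg (x ∷ s) = ℚP.+-mono-≤ (recip-nonneg x) (sumRecip-nonneg s)

recip≤sumRecip : ∀ x s → recip x ℚ.≤ sumRecip (x ∷ s)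
recip≤sumRecip x s = ℚP.≤-trans (ℚP.≤-reflexive (sym (ℚP.+-identityʳ (recip x))))
  (ℚP.+-monoʳ-≤ (recip x) (sumRecip-nonneg s))

sumRecip-snoc-antitone : ∀ s {y y′} .{{_ : NonZero y}} → y ≤ y′ →
                         sumRecip (s ++ y′ ∷ []) ℚ.≤ sumRecip (s ++ y ∷ [])
sumRecip-snoc-antitone []      y≤y′ = ℚP.+-monoˡ-≤ ℚ.0ℚ (recip-antitone y≤y′)
sumRecip-snoc-antitone (x ∷ s) y≤y′ = ℚP.+-monoʳ-≤ (recip x) (sumRecip-snoc-antitone s y≤y′)

-- σₙ₋₁ s is σ_{n−1}(s) for a list s of length n, so that sumRecip s = σₙ₋₁ s / product s.
σₙ₋₁ : List ℕ → ℕ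
σₙ₋₁ []      = 0
σₙ₋₁ (z ∷ s) = z ℕ.* σₙ₋₁ s ℕ.+ product s

sumRecip-snoc : ∀ s {y} → All NonZero s → .{{_ : NonZero y}} →
  sumRecip (s ++ y ∷ []) ≡ (+ σₙ₋₁ s ℤ.* + y ℤ.+ + product s) // (product s ℕ.* y)
sumRecip-snoc []      {y} []          = trans (//-+ (+ 1) (+ 0) y 1) (cong ((+ 1) //_) (ℕP.*-comm y 1))
sumRecip-snoc (z ∷ s) {y} (z≢0 ∷ s≢0) = begin
  recip z ℚ.+ sumRecip (s ++ y ∷ [])
    ≡⟨ cong (recip z ℚ.+_) (sumRecip-snoc s s≢0) ⟩
  (+ 1) // z ℚ.+ (+ N ℤ.* + y ℤ.+ + P) // (P ℕ.* y)
    ≡⟨ //-+ (+ 1) _ z (P ℕ.* y) {{z≢0}} {{ℕP.m*n≢0 P y {{product≢0 s≢0}}}} ⟩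
  (+ 1 ℤ.* + (P ℕ.* y) ℤ.+ (+ N ℤ.* + y ℤ.+ + P) ℤ.* + z) // (z ℕ.* (P ℕ.* y))
    ≡⟨ cong₂ _//_ numerator (sym (ℕP.*-assoc z P y)) ⟩
  (+ σₙ₋₁ (z ∷ s) ℤ.* + y ℤ.+ + product (z ∷ s)) // (product (z ∷ s) ℕ.* y) ∎
  where
  open ≡-Reasoning
  N = σₙ₋₁ s
  P = product s
  ring : ∀ Z N P Y → + 1 ℤ.* (P ℤ.* Y) ℤ.+ (N ℤ.* Y ℤ.+ P) ℤ.* Z ≡ (Z ℤ.* N ℤ.+ P) ℤ.* Y ℤ.+ Z ℤ.* P
  ring = solve-∀
  numerator : + 1 ℤ.* + (P ℕ.* y) ℤ.+ (+ N ℤ.* + y ℤ.+ + P) ℤ.* + z ≡ + σₙ₋₁ (z ∷ s) ℤ.* + y ℤ.+ + (z ℕ.* P)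
  numerator = begin
    + 1 ℤ.* + (P ℕ.* y) ℤ.+ (+ N ℤ.* + y ℤ.+ + P) ℤ.* + z
      ≡⟨ cong (λ u → + 1 ℤ.* u ℤ.+ (+ N ℤ.* + y ℤ.+ + P) ℤ.* + z) (ℤP.pos-* P y) ⟩
    + 1 ℤ.* (+ P ℤ.* + y) ℤ.+ (+ N ℤ.* + y ℤ.+ + P) ℤ.* + z
      ≡⟨ ring (+ z) (+ N) (+ P) (+ y) ⟩
    (+ z ℤ.* + N ℤ.+ + P) ℤ.* + y ℤ.+ + z ℤ.* + P
      ≡⟨ cong₂ (λ u v → u ℤ.* + y ℤ.+ v) (pos-*+ z N P) (ℤP.pos-* z P) ⟨
    + (z ℕ.* N ℕ.+ P) ℤ.* + y ℤ.+ + (z ℕ.* P) ∎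

-- Greedy steps

data GreedyChain : List ℕ → Set where
  []  : GreedyChain []
  _∷_ : ∀ {x xs} → GreedyStep (sumRecip (x ∷ xs)) x → GreedyChain xs → GreedyChain (x ∷ xs)

greedyStep-odd : ∀ {R x} → GreedyStep R x → Odd x
greedyStep-odd (inj₁ (_ , refl))    = 0 , refl
greedyStep-odd (inj₂ (_ , ox , _)) = ox

greedyStep-pos : ∀ {R x} → GreedyStep R x → ℚ.0ℚ ℚ.< R
greedyStep-pos (inj₁ (1≤R , _))            = ℚP.<-≤-trans (recip-pos 1) 1≤R
greedyStep-pos (inj₂ (_ , ox , 1/x≤R , _)) = ℚP.<-≤-trans (recip-pos _ {{odd⇒nonZero ox}}) 1/x≤R

p-r≡s⇔p≡r+s : ∀ p r s → p ℚ.- r ≡ s ⇔ p ≡ r ℚ.+ s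
p-r≡s⇔p≡r+s p r s = mk⇔
  (λ p-r≡s → begin
     p               ≡⟨ ℚ+.xyx⁻¹≈y r p ⟨
     r ℚ.+ p ℚ.- r   ≡⟨ ℚP.+-assoc r p (ℚ.- r) ⟩
     r ℚ.+ (p ℚ.- r) ≡⟨ cong (r ℚ.+_) p-r≡s ⟩
     r ℚ.+ s         ∎)
  (λ { refl → ℚ+.xyx⁻¹≈y r s })
  where open ≡-Reasoning

oddGreedy⇔ : ∀ {q} xs → OddGreedy q xs ⇔ (q ≡ sumRecip xs × GreedyChain xs)
oddGreedy⇔ []       = mk⇔ (λ { (stop q≡0) → q≡0 , [] }) (λ { (q≡0 , []) → stop q≡0 })
oddGreedy⇔ (x ∷ xs) = mk⇔
  (λ { (step _ gs og) → let (rest≡ , chain) = to (oddGreedy⇔ xs) og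
                            q≡ = to (p-r≡s⇔p≡r+s _ _ _) rest≡
                        in q≡ , subst (λ R → GreedyStep R x) q≡ gs ∷ chain })
  (λ { (refl , gs ∷ chain) → step (greedyStep-pos gs) gs
                               (from (oddGreedy⇔ xs) (from (p-r≡s⇔p≡r+s _ (recip x) _) refl , chain)) })

greedyStep⇔ : ∀ {R z} → Odd z → recip z ℚ.≤ R → GreedyStep R z ⇔ (z ≡ 1 ⊎ R ℚ.< recip (z ∸ 2))
greedyStep⇔ {R} {z} oz 1/z≤R = mk⇔ step⇒bound bound⇒step
  where
  step⇒bound : GreedyStep R z → z ≡ 1 ⊎ R ℚ.< recip (z ∸ 2)
  step⇒bound (inj₁ (_ , z≡1))        = inj₁ z≡1
  step⇒bound (inj₂ (_ , _ , _ , R<)) = inj₂ R<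
  bound⇒step : z ≡ 1 ⊎ R ℚ.< recip (z ∸ 2) → GreedyStep R z
  bound⇒step bound with odd⇒1⊎3≤ oz | bound
  ... | inj₁ z≡1 | _        = inj₁ (subst (λ w → recip w ℚ.≤ R) z≡1 1/z≤R , z≡1)
  ... | inj₂ 3≤z | inj₁ z≡1 = contradiction (subst (3 ≤_) z≡1 3≤z) λ { (s≤s ()) }
  ... | inj₂ 3≤z | inj₂ R<  =
    inj₂ (ℚP.<-≤-trans R< (recip-antitone (ℕP.∸-monoˡ-≤ 2 3≤z)) , oz , 1/z≤R , R<)

greedyChain-singleton : ∀ {y} → Odd y → GreedyChain (y ∷ [])
greedyChain-singleton {y} oy = from (greedyStep⇔ oy (recip≤sumRecip y [])) bound ∷ []
  where
  bound : y ≡ 1 ⊎ recip y ℚ.+ ℚ.0ℚ ℚ.< recip (y ∸ 2)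
  bound with odd⇒1⊎3≤ oy
  ... | inj₁ y≡1 = inj₁ y≡1
  ... | inj₂ 3≤y = inj₂ (subst (ℚ._< recip (y ∸ 2)) (sym (ℚP.+-identityʳ (recip y)))
    (from (//-<⇔ (+ 1) (+ 1) y (y ∸ 2) {{odd⇒nonZero oy}} {{ℕ.>-nonZero (ℕP.∸-monoˡ-≤ 2 3≤y)}})
      (subst₂ ℤ._<_ (sym (ℤP.*-identityˡ _)) (sym (ℤP.*-identityˡ _))
        (ℤ.+<+ (ℕP.∸-monoʳ-< {o = 0} (s≤s z≤n) (ℕP.≤-trans (ℕP.n≤1+n 2) 3≤y))))))

greedyChain-snoc-mono : ∀ {s y y′} → All Odd s → Odd y′ → .{{_ : NonZero y}} → y ≤ y′ →
                        GreedyChain (s ++ y ∷ []) → GreedyChain (s ++ y′ ∷ [])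
greedyChain-snoc-mono []        oy′ y≤y′ _ = greedyChain-singleton oy′
greedyChain-snoc-mono {z ∷ s} {y} {y′} (oz ∷ os) oy′ y≤y′ (gs ∷ chain) =
  step′ ∷ greedyChain-snoc-mono os oy′ y≤y′ chain
  where
  step′ : GreedyStep (sumRecip (z ∷ s ++ y′ ∷ [])) z
  step′ = from (greedyStep⇔ oz (recip≤sumRecip z (s ++ y′ ∷ [])))
    (map₂ (ℚP.≤-<-trans (sumRecip-snoc-antitone (z ∷ s) y≤y′))
          (to (greedyStep⇔ oz (recip≤sumRecip z (s ++ y ∷ []))) gs))

-- The greedy bound in closed form

+-cancelʳ-< : ∀ c {a b} → a ℤ.+ c ℤ.< b ℤ.+ c → a ℤ.< b
+-cancelʳ-< c {a} {b} lt =
  subst₂ ℤ._<_ (ℤ+.//-rightDividesʳ c a) (ℤ+.//-rightDividesʳ c b) (ℤP.+-monoˡ-< (ℤ.- c) lt)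

<⇔<-of-+≡+ : ∀ {a b c d} → a ℤ.+ d ≡ c ℤ.+ b → a ℤ.< b ⇔ c ℤ.< d
<⇔<-of-+≡+ {a} {b} {c} {d} a+d≡c+b = mk⇔
  (λ a<b → +-cancelʳ-< b (subst₂ ℤ._<_ a+d≡c+b (ℤP.+-comm b d) (ℤP.+-monoˡ-< d a<b)))
  (λ c<d → +-cancelʳ-< d (subst₂ ℤ._<_ (sym a+d≡c+b) (ℤP.+-comm d b) (ℤP.+-monoˡ-< b c<d)))

-- Num x i k and Den x i k, for the list z ∷ s = xᵢ, …, x_{k−1}.
NumList : ℕ → List ℕ → ℤ
NumList z s = (+ z ℤ.- + 2) ℤ.* + product (z ∷ s)

DenList : ℕ → List ℕ → ℤ
DenList z s = + 2 ℤ.* + σₙ₋₁ (z ∷ s) ℤ.- (+ z ℤ.* + z) ℤ.* + σₙ₋₁ s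

-- The left-hand side is R < 1/(z − 2) cross-multiplied, with R = A / D as in sumRecip-snoc.
cross-multiplied⇔Num<y*Den : ∀ z s y →
  (+ σₙ₋₁ (z ∷ s) ℤ.* + y ℤ.+ + product (z ∷ s)) ℤ.* (+ z ℤ.- + 2) ℤ.< + 1 ℤ.* + (product (z ∷ s) ℕ.* y)
  ⇔ NumList z s ℤ.< + y ℤ.* DenList z s
cross-multiplied⇔Num<y*Den z s y = <⇔<-of-+≡+
  (identity (+ z) (+ σₙ₋₁ s) (+ product s) (+ y) (pos-*+ z (σₙ₋₁ s) (product s)) (ℤP.pos-* z (product s))
    (trans (ℤP.pos-* (z ℕ.* product s) y) (cong (ℤ._* + y) (ℤP.pos-* z (product s)))))
  where
  ring : ∀ Z N P Y →
    ((Z ℤ.* N ℤ.+ P) ℤ.* Y ℤ.+ Z ℤ.* P) ℤ.* (Z ℤ.- + 2) ℤ.+ Y ℤ.* (+ 2 ℤ.* (Z ℤ.* N ℤ.+ P) ℤ.- (Z ℤ.* Z) ℤ.* N)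
    ≡ (Z ℤ.- + 2) ℤ.* (Z ℤ.* P) ℤ.+ + 1 ℤ.* (Z ℤ.* P ℤ.* Y)
  ring = solve-∀
  -- The casts to ℤ are abstracted as S, Q, D so that the identity becomes a ring identity.
  identity : ∀ Z N P Y {S Q D} → S ≡ Z ℤ.* N ℤ.+ P → Q ≡ Z ℤ.* P → D ≡ Z ℤ.* P ℤ.* Y →
             (S ℤ.* Y ℤ.+ Q) ℤ.* (Z ℤ.- + 2) ℤ.+ Y ℤ.* (+ 2 ℤ.* S ℤ.- (Z ℤ.* Z) ℤ.* N)
             ≡ (Z ℤ.- + 2) ℤ.* Q ℤ.+ + 1 ℤ.* D
  identity Z N P Y refl refl refl = ring Z N P Y

greedyStep⇔Num<y*Den : ∀ {z s y} → Odd z → All NonZero s → .{{_ : NonZero y}} →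
  GreedyStep (sumRecip (z ∷ s ++ y ∷ [])) z ⇔ NumList z s ℤ.< + y ℤ.* DenList z s
greedyStep⇔Num<y*Den {z} {s} {y} oz s≢0 with odd⇒1⊎3≤ oz
-- For z = 1 both sides hold: the step only needs R ≥ 1, and A · (1 − 2) ≤ 0 < D.
... | inj₁ refl = mk⇔ (λ _ → to (cross-multiplied⇔Num<y*Den 1 s y) A*[1-2]<D)
                      (λ _ → inj₁ (recip≤sumRecip 1 (s ++ y ∷ []) , refl))
  where
  open ℤP.≤-Reasoning
  A = + σₙ₋₁ (1 ∷ s) ℤ.* + y ℤ.+ + product (1 ∷ s)
  D = product (1 ∷ s) ℕ.* y
  0≤A : ℤ.0ℤ ℤ.≤ A
  0≤A = subst (ℤ.0ℤ ℤ.≤_) (pos-*+ (σₙ₋₁ (1 ∷ s)) y (product (1 ∷ s))) (ℤ.+≤+ z≤n)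
  0<D : ℤ.0ℤ ℤ.< + D
  0<D = ℤ.+<+ (ℕ.>-nonZero⁻¹ D {{ℕP.m*n≢0 (product (1 ∷ s)) y {{product≢0 {1 ∷ s} (_ ∷ s≢0)}}}})
  A*[1-2]<D : A ℤ.* (+ 1 ℤ.- + 2) ℤ.< + 1 ℤ.* + D
  A*[1-2]<D = begin-strict
    A ℤ.* ℤ.-1ℤ   ≡⟨ ℤP.*-comm A ℤ.-1ℤ ⟩
    ℤ.-1ℤ ℤ.* A   ≡⟨ ℤP.-1*i≡-i A ⟩
    ℤ.- A         ≤⟨ ℤP.neg-mono-≤ 0≤A ⟩
    ℤ.0ℤ          <⟨ 0<D ⟩
    + D           ≡⟨ ℤP.*-identityˡ (+ D) ⟨
    + 1 ℤ.* + D   ∎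
... | inj₂ 3≤z = cross-multiplied⇔Num<y*Den z s y
                   ⇔-∘ (bound⇔ ⇔-∘ greedyStep⇔ oz (recip≤sumRecip z (s ++ y ∷ [])))
  where
  A = + σₙ₋₁ (z ∷ s) ℤ.* + y ℤ.+ + product (z ∷ s)
  D = product (z ∷ s) ℕ.* y
  instance
    D≢0 : NonZero D
    D≢0 = ℕP.m*n≢0 _ y {{product≢0 (odd⇒nonZero oz ∷ s≢0)}}
    z-2≢0 : NonZero (z ∸ 2)
    z-2≢0 = ℕ.>-nonZero (ℕP.∸-monoˡ-≤ 2 3≤z)
  z-2≡ : + (z ∸ 2) ≡ + z ℤ.- + 2
  z-2≡ = sym (trans (ℤP.m-n≡m⊖n z 2) (ℤP.⊖-≥ (ℕP.≤-trans (ℕP.n≤1+n 2) 3≤z)))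
  R<⇔ : sumRecip (z ∷ s ++ y ∷ []) ℚ.< recip (z ∸ 2) ⇔ A ℤ.* (+ z ℤ.- + 2) ℤ.< + 1 ℤ.* + D
  R<⇔ = subst (λ R → R ℚ.< recip (z ∸ 2) ⇔ A ℤ.* (+ z ℤ.- + 2) ℤ.< + 1 ℤ.* + D)
          (sym (sumRecip-snoc (z ∷ s) (odd⇒nonZero oz ∷ s≢0)))
          (subst (λ w → A // D ℚ.< recip (z ∸ 2) ⇔ A ℤ.* w ℤ.< + 1 ℤ.* + D) z-2≡ (//-<⇔ A (+ 1) D (z ∸ 2)))
  bound⇔ : (z ≡ 1 ⊎ sumRecip (z ∷ s ++ y ∷ []) ℚ.< recip (z ∸ 2)) ⇔ A ℤ.* (+ z ℤ.- + 2) ℤ.< + 1 ℤ.* + D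
  bound⇔ = mk⇔ (λ { (inj₁ refl) → contradiction 3≤z λ { (s≤s ()) } ; (inj₂ R<) → to R<⇔ R< })
               (inj₂ ∘ from R<⇔)

-- Elementary symmetric polynomials

σₙ-beyond : ∀ s k → length s < k → σₙ k (map +_ s) ≡ ℤ.0ℤ
σₙ-beyond []      (suc k) _           = refl
σₙ-beyond (z ∷ s) (suc k) (s≤s |s|<k) = begin
  + z ℤ.* σₙ k (map +_ s) ℤ.+ σₙ (suc k) (map +_ s)
    ≡⟨ cong₂ (λ u v → + z ℤ.* u ℤ.+ v) (σₙ-beyond s k |s|<k) (σₙ-beyond s (suc k) (ℕP.m<n⇒m<1+n |s|<k)) ⟩
  + z ℤ.* ℤ.0ℤ ℤ.+ ℤ.0ℤ
    ≡⟨ trans (ℤP.+-identityʳ _) (ℤP.*-zeroʳ (+ z)) ⟩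
  ℤ.0ℤ ∎
  where open ≡-Reasoning

σₙ-length : ∀ s {k} → length s ≡ k → σₙ k (map +_ s) ≡ + product s
σₙ-length []      refl = refl
σₙ-length (z ∷ s) refl = begin
  + z ℤ.* σₙ (length s) (map +_ s) ℤ.+ σₙ (suc (length s)) (map +_ s)
    ≡⟨ cong₂ (λ u v → + z ℤ.* u ℤ.+ v) (σₙ-length s refl) (σₙ-beyond s _ ℕP.≤-refl) ⟩
  + z ℤ.* + product s ℤ.+ ℤ.0ℤ
    ≡⟨ trans (ℤP.+-identityʳ _) (sym (ℤP.pos-* z (product s))) ⟩
  + product (z ∷ s) ∎
  where open ≡-Reasoning

σₙ-length-∷ : ∀ z s {k} → length s ≡ k → σₙ k (map +_ (z ∷ s)) ≡ + σₙ₋₁ (z ∷ s)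
σₙ-length-∷ z []      refl = cong (λ u → + (u ℕ.+ 1)) (sym (ℕP.*-zeroʳ z))
σₙ-length-∷ z (w ∷ s) refl = begin
  + z ℤ.* σₙ (length s) (map +_ (w ∷ s)) ℤ.+ σₙ (suc (length s)) (map +_ (w ∷ s))
    ≡⟨ cong₂ (λ u v → + z ℤ.* u ℤ.+ v) (σₙ-length-∷ w s refl) (σₙ-length (w ∷ s) refl) ⟩
  + z ℤ.* + σₙ₋₁ (w ∷ s) ℤ.+ + product (w ∷ s)
    ≡⟨ pos-*+ z _ _ ⟨
  + σₙ₋₁ (z ∷ w ∷ s) ∎
  where open ≡-Reasoning

σ-length-1 : ∀ s {k} → length s ≡ k → σ (+ k ℤ.- + 1) (map +_ s) ≡ + σₙ₋₁ s
σ-length-1 []      refl = refl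
σ-length-1 (z ∷ s) refl = σₙ-length-∷ z s refl

σₙ-snoc : ∀ l k w → σₙ (suc k) (l ++ w ∷ []) ≡ σₙ (suc k) l ℤ.+ w ℤ.* σₙ k l
σₙ-snoc []      k       w = trans (ℤP.+-identityʳ (w ℤ.* σₙ k [])) (sym (ℤP.+-identityˡ (w ℤ.* σₙ k [])))
σₙ-snoc (v ∷ l) zero    w =
  trans (cong (ℤ._+_ (v ℤ.* + 1)) (σₙ-snoc l zero w)) (sym (ℤP.+-assoc (v ℤ.* + 1) (σₙ 1 l) (w ℤ.* + 1)))
σₙ-snoc (v ∷ l) (suc k) w =
  trans (cong₂ (λ u u′ → v ℤ.* u ℤ.+ u′) (σₙ-snoc l k w) (σₙ-snoc l (suc k) w))
        (ring v (σₙ (suc k) l) w (σₙ k l) (σₙ (suc (suc k)) l))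
  where
  ring : ∀ v s₁ w s₀ s₂ →
    v ℤ.* (s₁ ℤ.+ w ℤ.* s₀) ℤ.+ (s₂ ℤ.+ w ℤ.* s₁) ≡ (v ℤ.* s₁ ℤ.+ s₂) ℤ.+ w ℤ.* (v ℤ.* s₀ ℤ.+ s₁)
  ring = solve-∀

σₙ-snoc+2*σₙ*t : ∀ s {k} b t → length s ≡ suc k →
  σₙ (suc k) (map +_ s ++ + b ∷ []) ℤ.+ + 2 ℤ.* σₙ k (map +_ s) ℤ.* + t
  ≡ + σₙ₋₁ s ℤ.* + (b ℕ.+ 2 ℕ.* t) ℤ.+ + product s
σₙ-snoc+2*σₙ*t (z ∷ s) b t refl = begin
  σₙ (suc (length s)) (map +_ (z ∷ s) ++ + b ∷ []) ℤ.+ + 2 ℤ.* N ℤ.* + t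
    ≡⟨ cong (ℤ._+ + 2 ℤ.* N ℤ.* + t) (σₙ-snoc (map +_ (z ∷ s)) (length s) (+ b)) ⟩
  σₙ (suc (length s)) (map +_ (z ∷ s)) ℤ.+ + b ℤ.* N ℤ.+ + 2 ℤ.* N ℤ.* + t
    ≡⟨ cong₂ (λ P N′ → P ℤ.+ + b ℤ.* N′ ℤ.+ + 2 ℤ.* N′ ℤ.* + t) (σₙ-length (z ∷ s) refl) (σₙ-length-∷ z s refl) ⟩
  + product (z ∷ s) ℤ.+ + b ℤ.* + σₙ₋₁ (z ∷ s) ℤ.+ + 2 ℤ.* + σₙ₋₁ (z ∷ s) ℤ.* + t
    ≡⟨ ring (+ product (z ∷ s)) (+ σₙ₋₁ (z ∷ s)) (+ b) (+ t) ⟩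
  + σₙ₋₁ (z ∷ s) ℤ.* (+ b ℤ.+ + 2 ℤ.* + t) ℤ.+ + product (z ∷ s)
    ≡⟨ cong (λ u → + σₙ₋₁ (z ∷ s) ℤ.* u ℤ.+ + product (z ∷ s)) b+2t≡ ⟨
  + σₙ₋₁ (z ∷ s) ℤ.* + (b ℕ.+ 2 ℕ.* t) ℤ.+ + product (z ∷ s) ∎
  where
  open ≡-Reasoning
  N = σₙ (length s) (map +_ (z ∷ s))
  b+2t≡ : + (b ℕ.+ 2 ℕ.* t) ≡ + b ℤ.+ + 2 ℤ.* + t
  b+2t≡ = trans (ℤP.pos-+ b (2 ℕ.* t)) (cong (ℤ._+_ (+ b)) (ℤP.pos-* 2 t))
  ring : ∀ P N B T → P ℤ.+ B ℤ.* N ℤ.+ + 2 ℤ.* N ℤ.* T ≡ N ℤ.* (B ℤ.+ + 2 ℤ.* T) ℤ.+ P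
  ring = solve-∀

prodℤ-map : ∀ s → prodℤ (map +_ s) ≡ + product s
prodℤ-map []      = refl
prodℤ-map (z ∷ s) = trans (cong (+ z ℤ.*_) (prodℤ-map s)) (sym (ℤP.pos-* z (product s)))

module _ (x : ℕ → ℕ) where

  segment : ℕ → ℕ → List ℕ
  segment i zero    = []
  segment i (suc l) = x i ∷ segment (suc i) l

  length-segment : ∀ i l → length (segment i l) ≡ l
  length-segment i zero    = refl
  length-segment i (suc l) = cong suc (length-segment (suc i) l)

  All-segment : ∀ {P : ℕ → Set} {N} l i → i ℕ.+ l ≡ suc N →
                (∀ k → i ≤ k → k ≤ N → P (x k)) → All P (segment i l)
  All-segment zero    i _ _  = []
  All-segment (suc l) i e px = px i ℕP.≤-refl (m+1+n≡1+o⇒m≤o e)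
    ∷ All-segment l (suc i) (trans (sym (ℕP.+-suc i l)) e) (λ k i<k → px k (ℕP.<⇒≤ i<k))

  applyUpTo-segment : ∀ {A : Set} (g : ℕ → A) {f} i l → (∀ j → f j ≡ g (x (i ℕ.+ j))) →
                      applyUpTo f l ≡ map g (segment i l)
  applyUpTo-segment g i zero    _  = refl
  applyUpTo-segment g i (suc l) f≗ = cong₂ _∷_ (trans (f≗ 0) (cong (g ∘ x) (ℕP.+-identityʳ i)))
    (applyUpTo-segment g (suc i) l (λ j → trans (f≗ (suc j)) (cong (g ∘ x) (ℕP.+-suc i j))))

  seg≡segment : ∀ i l → seg x i l ≡ map +_ (segment i l)
  seg≡segment i l = trans (map-applyUpTo id _ l) (applyUpTo-segment +_ i l λ _ → refl)

  upTo≡segment : ∀ l → map (λ j → x (suc j)) (upTo l) ≡ segment 1 l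
  upTo≡segment l = trans (map-applyUpTo id _ l) (trans (applyUpTo-segment id 1 l λ _ → refl) (map-id _))

  Num-segment : ∀ i l → Num x i (i ℕ.+ suc l) ≡ NumList (x i) (segment (suc i) l)
  Num-segment i l = cong ((+ x i ℤ.- + 2) ℤ.*_) (begin
    prodℤ (seg x i (i ℕ.+ suc l ∸ i))  ≡⟨ cong (prodℤ ∘ seg x i) (ℕP.m+n∸m≡n i (suc l)) ⟩
    prodℤ (seg x i (suc l))            ≡⟨ cong prodℤ (seg≡segment i (suc l)) ⟩
    prodℤ (map +_ (segment i (suc l))) ≡⟨ prodℤ-map (segment i (suc l)) ⟩
    + product (segment i (suc l))      ∎)
    where open ≡-Reasoning

  Den-segment : ∀ i l → Den x i (i ℕ.+ suc l) ≡ DenList (x i) (segment (suc i) l)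
  Den-segment i l = cong₂ (λ u v → + 2 ℤ.* u ℤ.- (+ x i ℤ.* + x i) ℤ.* v) whole tail
    where
    open ≡-Reasoning
    offset : ∀ a b c → a ℤ.+ b ℤ.- a ℤ.- c ≡ b ℤ.- c
    offset = solve-∀
    pred-offset : ∀ b → + 1 ℤ.+ b ℤ.- + 2 ≡ b ℤ.- + 1
    pred-offset = solve-∀
    index : ∀ c → + (i ℕ.+ suc l) ℤ.- + i ℤ.- c ≡ + suc l ℤ.- c
    index c = trans (cong (λ u → u ℤ.- + i ℤ.- c) (ℤP.pos-+ i (suc l))) (offset (+ i) (+ suc l) c)
    whole : σ (+ (i ℕ.+ suc l) ℤ.- + i ℤ.- + 1) (seg x i (i ℕ.+ suc l ∸ i)) ≡ + σₙ₋₁ (segment i (suc l))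
    whole = begin
      σ (+ (i ℕ.+ suc l) ℤ.- + i ℤ.- + 1) (seg x i (i ℕ.+ suc l ∸ i))
        ≡⟨ cong₂ σ (index (+ 1)) (trans (cong (seg x i) (ℕP.m+n∸m≡n i (suc l))) (seg≡segment i (suc l))) ⟩
      σₙ l (map +_ (segment i (suc l)))
        ≡⟨ σₙ-length-∷ (x i) (segment (suc i) l) (length-segment (suc i) l) ⟩
      + σₙ₋₁ (segment i (suc l)) ∎
    tail : σ (+ (i ℕ.+ suc l) ℤ.- + i ℤ.- + 2) (seg x (suc i) (i ℕ.+ suc l ∸ i ∸ 1))
           ≡ + σₙ₋₁ (segment (suc i) l)
    tail = begin
      σ (+ (i ℕ.+ suc l) ℤ.- + i ℤ.- + 2) (seg x (suc i) (i ℕ.+ suc l ∸ i ∸ 1))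
        ≡⟨ cong₂ σ (trans (index (+ 2)) (pred-offset (+ l)))
                   (trans (cong (λ n → seg x (suc i) (n ∸ 1)) (ℕP.m+n∸m≡n i (suc l))) (seg≡segment (suc i) l)) ⟩
      σ (+ l ℤ.- + 1) (map +_ (segment (suc i) l))
        ≡⟨ σ-length-1 (segment (suc i) l) (length-segment (suc i) l) ⟩
      + σₙ₋₁ (segment (suc i) l) ∎

  AboveBounds : ℕ → ℕ → ℕ → Set
  AboveBounds i N y = ∀ k → i ≤ k → k ≤ N → Num x k (suc N) ℤ.< + y ℤ.* Den x k (suc N)

  greedyChain-segment⇔ : ∀ {N y} l i → i ℕ.+ l ≡ suc N → (∀ k → i ≤ k → k ≤ N → Odd (x k)) →
                         GreedyChain (segment i l ++ y ∷ []) ⇔ (Odd y × AboveBounds i N y)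
  greedyChain-segment⇔ zero i i+0≡1+N _ = mk⇔
    (λ { (gs ∷ []) → greedyStep-odd gs , λ k i≤k k≤N →
           contradiction (s≤s (ℕP.≤-trans i≤k k≤N)) (ℕP.<-irrefl (trans (sym (ℕP.+-identityʳ i)) i+0≡1+N)) })
    (λ (oy , _) → greedyChain-singleton oy)
  greedyChain-segment⇔ {N} {y} (suc l) i e odd = mk⇔
    (λ { (gs ∷ chain) → let (oy , bounds) = to rest⇔ chain in oy , bounds-∷ (to (head⇔ oy) gs) bounds })
    (λ (oy , bounds) → from (head⇔ oy) (bounds i ℕP.≤-refl i≤N)
                       ∷ from rest⇔ (oy , λ k i<k → bounds k (ℕP.<⇒≤ i<k)))
    where
    i≤N : i ≤ N
    i≤N = m+1+n≡1+o⇒m≤o e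
    e′ : suc i ℕ.+ l ≡ suc N
    e′ = trans (sym (ℕP.+-suc i l)) e
    rest⇔ : GreedyChain (segment (suc i) l ++ y ∷ []) ⇔ (Odd y × AboveBounds (suc i) N y)
    rest⇔ = greedyChain-segment⇔ l (suc i) e′ (λ k i<k → odd k (ℕP.<⇒≤ i<k))
    Step : Set
    Step = GreedyStep (sumRecip (segment i (suc l) ++ y ∷ [])) (x i)
    head⇔ : Odd y → Step ⇔ Num x i (suc N) ℤ.< + y ℤ.* Den x i (suc N)
    head⇔ oy = subst (λ M → Step ⇔ Num x i M ℤ.< + y ℤ.* Den x i M) e
      (subst₂ (λ a b → Step ⇔ a ℤ.< + y ℤ.* b) (sym (Num-segment i l)) (sym (Den-segment i l))
        (greedyStep⇔Num<y*Den (odd i ℕP.≤-refl i≤N)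
          (All.map odd⇒nonZero (All-segment l (suc i) e′ (λ k i<k → odd k (ℕP.<⇒≤ i<k))))
          {{odd⇒nonZero oy}}))
    bounds-∷ : Num x i (suc N) ℤ.< + y ℤ.* Den x i (suc N) → AboveBounds (suc i) N y → AboveBounds i N y
    bounds-∷ head rest k i≤k k≤N with ℕP.m≤n⇒m<n∨m≡n i≤k
    ... | inj₁ i<k  = rest k i<k k≤N
    ... | inj₂ refl = head

  oddGreedy-prefix⇔ : ∀ n {q y} → (∀ k → 1 ≤ k → k ≤ n → Odd (x k)) →
    OddGreedy q (map (λ j → x (suc j)) (upTo n) ++ y ∷ []) ⇔
    (q ≡ sumRecip (segment 1 n ++ y ∷ []) × Odd y × AboveBounds 1 n y)
  oddGreedy-prefix⇔ n odd rewrite upTo≡segment n =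
    (⇔-id _ ×-⇔ greedyChain-segment⇔ n 1 refl odd) ⇔-∘ oddGreedy⇔ _

  aboveBounds-mono : ∀ n {b y} → (∀ k → 1 ≤ k → k ≤ n → Odd (x k)) → Odd b → Odd y → b ≤ y →
                     AboveBounds 1 n b → AboveBounds 1 n y
  aboveBounds-mono n odd ob oy b≤y above = proj₂ (to (greedyChain-segment⇔ n 1 refl odd)
    (greedyChain-snoc-mono (All-segment n 1 refl odd) oy {{odd⇒nonZero ob}} b≤y
      (from (greedyChain-segment⇔ n 1 refl odd) (ob , above))))

  sumRecip-prefix : ∀ n b t → (∀ k → 1 ≤ k → k ≤ suc n → Odd (x k)) → Odd b →
    sumRecip (segment 1 (suc n) ++ b ℕ.+ 2 ℕ.* t ∷ [])
    ≡ (σₙ (suc n) (seg x 1 (suc n) ++ + b ∷ []) ℤ.+ + 2 ℤ.* σₙ n (seg x 1 (suc n)) ℤ.* + t)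
      // (product (map (λ j → x (suc j)) (upTo (suc n))) ℕ.* b
          ℕ.+ 2 ℕ.* product (map (λ j → x (suc j)) (upTo (suc n))) ℕ.* t)
  sumRecip-prefix n b t odd ob = trans
    (sumRecip-snoc xs (All.map odd⇒nonZero (All-segment (suc n) 1 refl odd)) {{odd⇒nonZero (odd-+-even t ob)}})
    (sym (cong₂ _//_
      (trans (cong (λ L → σₙ (suc n) (L ++ + b ∷ []) ℤ.+ + 2 ℤ.* σₙ n L ℤ.* + t) (seg≡segment 1 (suc n)))
             (σₙ-snoc+2*σₙ*t xs b t (length-segment 1 (suc n))))
      (trans (cong (λ L → product L ℕ.* b ℕ.+ 2 ℕ.* product L ℕ.* t) (upTo≡segment (suc n)))
             (factor (product xs) b t))))
    where
    xs = segment 1 (suc n)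
    factor : ∀ P b t → P ℕ.* b ℕ.+ 2 ℕ.* P ℕ.* t ≡ P ℕ.* (b ℕ.+ 2 ℕ.* t)
    factor = ℕ-Solver.solve-∀

theorem3p2 : (m : ℕ) → 2 ≤ m → (x : ℕ → ℕ)
    → (∀ i → 1 ≤ i → i ≤ m ∸ 1 → Odd (x i))
    → (∀ i k → 1 ≤ i → i < k → k ≤ m ∸ 1 → Num x i k ℤ.< (+ x k) ℤ.* Den x i k)
    → (b : ℕ) → Odd b
    → (∀ i → 1 ≤ i → i ≤ m ∸ 1 → Num x i m ℤ.< (+ b) ℤ.* Den x i m)
    → (∀ b′ → Odd b′ → (∀ i → 1 ≤ i → i ≤ m ∸ 1 → Num x i m ℤ.< (+ b′) ℤ.* Den x i m) → b ≤ b′)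
    → (q : ℚ)
    → (Σ ℕ λ y → OddGreedy q (map (λ j → x (suc j)) (upTo (m ∸ 1)) ++ (y ∷ [])))
      ⇔ (Σ ℕ λ t → q ≡ ((σ (+ m ℤ.- + 1) (seg x 1 (m ∸ 1) ++ ((+ b) ∷ []))
                          ℤ.+ (+ 2) ℤ.* σ (+ m ℤ.- + 2) (seg x 1 (m ∸ 1)) ℤ.* (+ t))
                         // (foldr ℕ._*_ 1 (map (λ j → x (suc j)) (upTo (m ∸ 1))) ℕ.* b
                             ℕ.+ 2 ℕ.* foldr ℕ._*_ 1 (map (λ j → x (suc j)) (upTo (m ∸ 1))) ℕ.* t)))
theorem3p2 (suc (suc n)) (s≤s (s≤s z≤n)) x odd _ b ob b-above b-least _ = mk⇔
  (λ (y , expansion) →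
    let (q≡ , oy , y-above) = to (oddGreedy-prefix⇔ x (suc n) odd) expansion
        (t , y≡b+2t)        = odd-≤⇒≡+2* ob oy (b-least y oy y-above)
    in t , trans q≡ (trans (cong (λ y → sumRecip (segment x 1 (suc n) ++ y ∷ [])) y≡b+2t)
                           (sumRecip-prefix x n b t odd ob)))
  (λ (t , q≡) → b ℕ.+ 2 ℕ.* t , from (oddGreedy-prefix⇔ x (suc n) odd)
    ( trans q≡ (sym (sumRecip-prefix x n b t odd ob))
    , odd-+-even t ob
    , aboveBounds-mono x (suc n) odd ob (odd-+-even t ob) (ℕP.m≤m+n b (2 ℕ.* t)) b-above))
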